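{- Let $k>1$ be an integer. Then there is an admissible set $\mathcal H=\{h_1,\ldots,h_k\}$ of integers with $h_1=0<h_2<\cdots<h_k$ having the following properties: (i) all of $h_1,h_2,\ldots,h_k$ are multiples of $K=4\prod_{p<2k}p$ (product over primes $p<2k$); (ii) for each $1\leqslant i<j\leqslant k$, the number $h_i-h_j$ has a prime divisor $p>2k$ with $h_i\not\equiv h_j\pmod{p^2}$; (iii) if $1\leqslant i<j\leqslant k$, $1\leqslant s<t\leqslant k$ and $\{i,j\}\neq\{s,t\}$, then no prime $p>2k$ divides both $h_i-h_j$ and $h_s-h_t$.
   Context: A finite set $\{h_1,\ldots,h_k\}$ of distinct integers is called admissible if for every prime $p$ the union of residue classes $\bigcup_{i=1}^k (h_i+p\mathbb Z)$ is not all of $\mathbb Z$. Throughout, $p$ denotes a prime. -}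

module Defs where

open import Data.Nat as ℕ using (ℕ; zero; suc)
open import Data.Nat.Primality using (Prime; prime?)
open import Data.Integer as ℤ using (ℤ; +_; _-_)
open import Data.Integer.Divisibility using (_∣_)
open import Data.Fin using (Fin)
open import Relation.Nullary using (¬_; yes; no)
open import Data.Product using (∃)

primeProdBelow : ℕ → ℕ
primeProdBelow zero = 1
primeProdBelow (suc n) with prime? n
... | yes _ = n ℕ.* primeProdBelow n
... | no  _ = primeProdBelow n

Admissible : {k : ℕ} → (Fin k → ℤ) → Set
Admissible {k} h = ∀ (p : ℕ) → Prime p → ∃ λ (n : ℤ) → ∀ (i : Fin k) → ¬ ((+ p) ∣ (n - h i))

-- Build 0 = h₀ < h₁ < ⋯ one term at a time so that (ii) and (iii) hold for the primes p > B = 2k,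
-- then multiply everything by K, which no such prime divides. A new term x comes from the Chinese
-- remainder theorem: for each earlier hᵢ pick a fresh prime rᵢ > B and require x ≡ hᵢ + rᵢ (mod rᵢ²),
-- so that rᵢ divides hᵢ - x exactly once; and for each prime B < p small enough to divide an old
-- difference require x to avoid the classes of the m < p earlier terms mod p, so that no such prime
-- divides a new difference. Periodicity of these conditions lets x exceed every earlier term.
-- Admissibility: a prime p ≤ k divides K and hence every hᵢ, while k classes cannot cover ℤ/p for p > k.
module Submission where

open import Defs
open import Data.Nat as ℕ using (ℕ)
open import Data.Nat.Primality using (Prime)
open import Data.Integer as ℤ using (ℤ; +_; _-_)
open import Data.Integer.Divisibility using (_∣_)
open import Data.Fin as Fin using (Fin; toℕ)
open import Data.Product using (∃; _×_)
open import Relation.Nullary using (¬_)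
open import Relation.Binary.PropositionalEquality using (_≡_; _≢_)

open import Data.Nat using (zero; suc; NonZero; _<_; _≤_)
import Data.Nat.Properties as ℕ
open import Data.Nat.Divisibility as ℕ using () renaming (_∣_ to _∣ℕ_)
open import Data.Nat.Coprimality as Coprime using (Coprime; coprime-Bézout; coprime-divisor; prime⇒coprime)
open import Data.Nat.GCD using (module Bézout)
open import Data.Nat.Primality using (prime⇒nonZero; prime⇒nonTrivial; prime⇒irreducible; euclidsLemma; prime?)
open import Data.Nat.Primality.Factorisation using (factorise)
open import Data.Nat.ListAction using (product)
open import Data.Integer using (-_; _+_; _*_)
import Data.Integer.Properties as ℤ
import Data.Integer.Divisibility.Signed as Signed
import Data.Integer.Coprimality as ℤ
open import Data.Integer.Tactic.RingSolver using (solve-∀)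
import Data.Fin.Properties as Fin
open import Data.List using ([]; _∷_)
open import Data.List.Relation.Unary.All using (_∷_)
open import Data.Product as Product using (∃₂; _,_; proj₁; proj₂)
open import Data.Sum using (_⊎_; inj₁; inj₂)
open import Data.Empty using (⊥; ⊥-elim)
open import Function using (_∘_)
open import Relation.Nullary using (Dec; yes; no)
import Relation.Nullary.Decidable as Dec
open import Relation.Binary.Definitions using (tri<; tri≈; tri>)
open import Relation.Binary.PropositionalEquality using (refl; sym; trans; cong; subst; module ≡-Reasoning)

-- Congruences

-- A record rather than a synonym for (+ n) ∣ (x - y), so that x, y and n are inferable.
infix 4 _≡_mod_
record _≡_mod_ (x y : ℤ) (n : ℕ) : Set where
  constructor ≡-mod
  field divides : + n Signed.∣ x - y

≡-mod-intro : ∀ {n x y} k → x - y ≡ k * + n → x ≡ y mod n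
≡-mod-intro k eq = ≡-mod (Signed.divides k eq)

≡-mod-sym : ∀ {n x y} → x ≡ y mod n → y ≡ x mod n
≡-mod-sym {x = x} {y} (≡-mod d) = ≡-mod (subst (_ Signed.∣_) (e x y) (Signed.∣m⇒∣-m d))
  where e : ∀ x y → - (x - y) ≡ y - x
        e = solve-∀

≡-mod-trans : ∀ {n x y z} → x ≡ y mod n → y ≡ z mod n → x ≡ z mod n
≡-mod-trans {x = x} {y} {z} (≡-mod d) (≡-mod e) =
  ≡-mod (subst (_ Signed.∣_) (eq x y z) (Signed.∣m∣n⇒∣m+n d e))
  where eq : ∀ x y z → (x - y) + (y - z) ≡ x - z
        eq = solve-∀

≡-mod-∣ : ∀ {d n x y} → d ∣ℕ n → x ≡ y mod n → x ≡ y mod d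
≡-mod-∣ d∣n (≡-mod e) = ≡-mod (Signed.∣-trans (Signed.∣ᵤ⇒∣ d∣n) e)

≡-mod-*ˡ : ∀ {n x y} c → x ≡ y mod n → c * x ≡ c * y mod n
≡-mod-*ˡ {x = x} {y} c (≡-mod n∣x-y) = ≡-mod (subst (_ Signed.∣_) (e c x y) (Signed.∣n⇒∣m*n c n∣x-y))
  where e : ∀ c x y → c * (x - y) ≡ c * x - c * y
        e = solve-∀

≡-mod-*ˡ-cancel : ∀ {n K x y} → Coprime n K → + K * x ≡ + K * y mod n → x ≡ y mod n
≡-mod-*ˡ-cancel {n} {K} {x} {y} n⊥K (≡-mod n∣Kx-Ky) =
  ≡-mod (Signed.∣ᵤ⇒∣ (ℤ.coprime-divisor (+ n) (+ K) (x - y) n⊥K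
    (Signed.∣⇒∣ᵤ (subst (_ Signed.∣_) (e (+ K) x y) n∣Kx-Ky))))
  where e : ∀ c x y → c * x - c * y ≡ c * (x - y)
        e = solve-∀

≡-mod⇒∣ : ∀ {n x y} → x ≡ y mod n → (+ n) ∣ (x - y)
≡-mod⇒∣ (≡-mod n∣x-y) = Signed.∣⇒∣ᵤ n∣x-y

∣⇒≡-mod : ∀ {n x y} → (+ n) ∣ (x - y) → x ≡ y mod n
∣⇒≡-mod n∣x-y = ≡-mod (Signed.∣ᵤ⇒∣ n∣x-y)

≡-mod? : ∀ x y n → Dec (x ≡ y mod n)
≡-mod? x y n = Dec.map′ ≡-mod _≡_mod_.divides (+ n Signed.∣? x - y)

≡-mod-+ : ∀ {n} a → a + + n ≡ a mod n
≡-mod-+ {n} a = ≡-mod-intro (+ 1) (e a (+ n))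
  where e : ∀ a n → a + n - a ≡ + 1 * n
        e = solve-∀

≡-mod-multiple : ∀ {n} a → + n * a ≡ + 0 mod n
≡-mod-multiple {n} a = ≡-mod-intro a (e (+ n) a)
  where e : ∀ n a → n * a - + 0 ≡ a * n
        e = solve-∀

≢-mod-+ : ∀ {n d} a → 0 < n → n < d → ¬ a + + n ≡ a mod d
≢-mod-+ {n} {d} a 0<n n<d (≡-mod d∣a+n-a) =
  ℕ.<⇒≱ n<d (ℕ.∣⇒≤ {{ℕ.>-nonZero 0<n}} (Signed.∣⇒∣ᵤ d∣n))
  where
    d∣n : + d Signed.∣ + n
    d∣n = subst (+ d Signed.∣_) (e a (+ n)) d∣a+n-a
      where e : ∀ a n → a + n - a ≡ n
            e = solve-∀

≡-mod-+-exact : ∀ {r a y} → 1 < r → y ≡ a + + r mod r ℕ.* r → a ≡ y mod r × ¬ a ≡ y mod r ℕ.* r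
≡-mod-+-exact {r} {a} 1<r y≡a+r =
  ≡-mod-trans (≡-mod-sym (≡-mod-+ a)) (≡-mod-sym (≡-mod-∣ (ℕ.m∣m*n r) y≡a+r)) ,
  λ a≡y → ≢-mod-+ a 0<r (ℕ.m<m*n r r {{ℕ.>-nonZero 0<r}} 1<r)
            (≡-mod-trans (≡-mod-sym y≡a+r) (≡-mod-sym a≡y))
  where 0<r : 0 < r
        0<r = ℕ.<-trans ℕ.z<s 1<r

distinct-residues : ∀ {a b p} → a < b → b < p → ¬ + a ≡ + b mod p
distinct-residues {a} {b} {p} a<b b<p a≡b =
  ≢-mod-+ (+ a) (ℕ.m<n⇒0<n∸m a<b) (ℕ.≤-<-trans (ℕ.m∸n≤m b a) b<p)
    (subst (λ z → z ≡ + a mod p) b≡a+[b∸a] (≡-mod-sym a≡b))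
  where
    b≡a+[b∸a] : + b ≡ + a + + (b ℕ.∸ a)
    b≡a+[b∸a] = trans (cong +_ (sym (ℕ.m+[n∸m]≡n (ℕ.<⇒≤ a<b)))) (ℤ.pos-+ a (b ℕ.∸ a))

≡-mod⇒≤∣-∣ : ∀ {p x y} → x ≢ y → x ≡ y mod p → p ≤ ℤ.∣ x - y ∣
≡-mod⇒≤∣-∣ {x = x} {y} x≢y (≡-mod p∣x-y) = ℕ.∣⇒≤ {{∣x-y∣≢0}} (Signed.∣⇒∣ᵤ p∣x-y)
  where
    ∣x-y∣≢0 : NonZero ℤ.∣ x - y ∣
    ∣x-y∣≢0 = ℕ.≢-nonZero λ ∣x-y∣≡0 →
      x≢y (ℤ.i-j≡0⇒i≡j x y (ℤ.∣i∣≡0⇒i≡0 ∣x-y∣≡0))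

∣i-j∣≤∣k∣ : ∀ {i j k} → + 0 ℤ.≤ i → i ℤ.≤ j → j ℤ.≤ k →
            ℤ.∣ i - j ∣ ℕ.≤ ℤ.∣ k ∣
∣i-j∣≤∣k∣ {+ n} {j} {k} 0≤i i≤j j≤k = ℤ.drop‿+≤+ (begin
  + ℤ.∣ + n - j ∣ ≡⟨ ℤ.∣-∣-≤ i≤j ⟩
  j - + n         ≤⟨ ℤ.i-j≤i j (+ n) ⟩
  j               ≤⟨ j≤k ⟩
  k               ≡⟨ ℤ.0≤i⇒+∣i∣≡i (ℤ.≤-trans 0≤i (ℤ.≤-trans i≤j j≤k)) ⟨
  + ℤ.∣ k ∣       ∎)
  where open ℤ.≤-Reasoning

i≤+∣i∣ : ∀ i → i ℤ.≤ + ℤ.∣ i ∣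
i≤+∣i∣ (+ n) = ℤ.≤-refl
i≤+∣i∣ ℤ.-[1+ n ] = ℤ.-≤+

pos-1+* : ∀ a b c d → 1 ℕ.+ a ℕ.* b ≡ c ℕ.* d → + 1 + + a * + b ≡ + c * + d
pos-1+* a b c d eq = begin
  + 1 + + a * + b   ≡⟨ cong (λ z → + 1 + z) (ℤ.pos-* a b) ⟨
  + (1 ℕ.+ a ℕ.* b) ≡⟨ cong +_ eq ⟩
  + (c ℕ.* d)       ≡⟨ ℤ.pos-* c d ⟩
  + c * + d         ∎
  where open ≡-Reasoning

ℤ-bézout : ∀ {m n} → Coprime m n → ∃₂ λ k l → k * + m + l * + n ≡ + 1
ℤ-bézout {m} {n} c with coprime-Bézout c
... | Bézout.+- x y eq = + x , - + y , (begin
  + x * + m + - + y * + n           ≡⟨ cong (_+ - + y * + n) (pos-1+* y n x m eq) ⟨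
  + 1 + + y * + n + - + y * + n     ≡⟨ cancel (+ y) (+ n) ⟩
  + 1                               ∎)
  where open ≡-Reasoning
        cancel : ∀ a b → + 1 + a * b + - a * b ≡ + 1
        cancel = solve-∀
... | Bézout.-+ x y eq = - + x , + y , (begin
  - + x * + m + + y * + n           ≡⟨ cong (λ z → - + x * + m + z) (pos-1+* x m y n eq) ⟨
  - + x * + m + (+ 1 + + x * + m)   ≡⟨ cancel (+ x) (+ m) ⟩
  + 1                               ∎)
  where open ≡-Reasoning
        cancel : ∀ a b → - a * b + (+ 1 + a * b) ≡ + 1
        cancel = solve-∀

-- Opaque: letting Agda unfold the Bézout witness inside later `with`s makes type checking blow up.
opaque
  crt : ∀ {m n} → Coprime m n → ∀ a b → ∃ λ x → x ≡ a mod m × x ≡ b mod n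
  crt {m} {n} c a b with ℤ-bézout c
  ... | k , l , eq = x , ≡-mod-intro {x = x} {a} ((b - a) * k) x≡a , ≡-mod-intro {x = x} {b} ((a - b) * l) x≡b
    where
      open ≡-Reasoning
      x : ℤ
      x = a * (l * + n) + b * (k * + m)
      unit : ∀ c → c * (k * + m + l * + n) ≡ c
      unit c = trans (cong (c *_) eq) (ℤ.*-identityʳ c)
      x≡a : x - a ≡ (b - a) * k * + m
      x≡a = begin
        x - a                         ≡⟨ cong (_-_ x) (unit a) ⟨
        x - a * (k * + m + l * + n)   ≡⟨ e a b k l (+ m) (+ n) ⟩
        (b - a) * k * + m             ∎
        where e : ∀ a b k l m n → a * (l * n) + b * (k * m) - a * (k * m + l * n) ≡ (b - a) * k * m
              e = solve-∀
      x≡b : x - b ≡ (a - b) * l * + n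
      x≡b = begin
        x - b                         ≡⟨ cong (_-_ x) (unit b) ⟨
        x - b * (k * + m + l * + n)   ≡⟨ e a b k l (+ m) (+ n) ⟩
        (a - b) * l * + n             ∎
        where e : ∀ a b k l m n → a * (l * n) + b * (k * m) - b * (k * m + l * n) ≡ (a - b) * l * n
              e = solve-∀

-- Primes

prime>1 : ∀ {p} → Prime p → 1 < p
prime>1 {p} pp = ℕ.nonTrivial⇒n>1 p {{prime⇒nonTrivial pp}}

prime∤1 : ∀ {p} → Prime p → ¬ p ∣ℕ 1
prime∤1 pp p∣1 = ℕ.<-irrefl (sym (ℕ.∣1⇒≡1 p∣1)) (prime>1 pp)

prime-divisor : ∀ n → .{{NonZero n}} → 1 < n → ∃ λ p → Prime p × p ∣ℕ n
prime-divisor n 1<n with factorise n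
... | record { factors = [] ; isFactorisation = n≡1 } = ⊥-elim (ℕ.<-irrefl (sym n≡1) 1<n)
... | record { factors = p ∷ ps ; isFactorisation = n≡p*ps ; factorsPrime = pp ∷ _ } =
  p , pp , subst (p ∣ℕ_) (sym n≡p*ps) (ℕ.m∣m*n (product ps))

m≤n⇒m∣n! : ∀ {m n} → .{{NonZero m}} → m ≤ n → m ∣ℕ n ℕ.!
m≤n⇒m∣n! {suc m} m≤n = ℕ.∣-trans (ℕ.m∣m*n (m ℕ.!)) (ℕ.m≤n⇒m!∣n! m≤n)

fresh-prime : ∀ N → ∃ λ p → Prime p × N < p
fresh-prime N with prime-divisor (suc (N ℕ.!)) (ℕ.s≤s (ℕ.1≤n! N))
... | p , pp , p∣1+N! = p , pp , ℕ.≰⇒> p≰N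
  where
    instance
      p≢0 : NonZero p
      p≢0 = prime⇒nonZero pp
    p≰N : ¬ p ≤ N
    p≰N p≤N = prime∤1 pp
      (ℕ.∣m+n∣m⇒∣n (subst (p ∣ℕ_) (ℕ.+-comm 1 (N ℕ.!)) p∣1+N!) (m≤n⇒m∣n! p≤N))

prime∤⇒coprime : ∀ {p n} → Prime p → ¬ p ∣ℕ n → Coprime n p
prime∤⇒coprime pp p∤n (d∣n , d∣p) with prime⇒irreducible pp d∣p
... | inj₁ d≡1 = d≡1
... | inj₂ refl = ⊥-elim (p∤n d∣n)

coprime-* : ∀ {m n o} → Coprime m n → Coprime m o → Coprime m (n ℕ.* o)
coprime-* c₁ c₂ (d∣m , d∣no) =
  c₂ (d∣m , coprime-divisor (λ (e∣d , e∣n) → c₁ (ℕ.∣-trans e∣d d∣m , e∣n)) d∣no)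

primeProdBelow≢0 : ∀ n → NonZero (primeProdBelow n)
primeProdBelow≢0 zero = _
primeProdBelow≢0 (suc n) with prime? n
... | yes pn = ℕ.m*n≢0 n (primeProdBelow n) {{prime⇒nonZero pn}} {{primeProdBelow≢0 n}}
... | no _ = primeProdBelow≢0 n

prime∣primeProdBelow⇒< : ∀ {p} n → Prime p → p ∣ℕ primeProdBelow n → p < n
prime∣primeProdBelow⇒< zero pp p∣1 = ⊥-elim (prime∤1 pp p∣1)
prime∣primeProdBelow⇒< (suc n) pp p∣ with prime? n
... | no _ = ℕ.m<n⇒m<1+n (prime∣primeProdBelow⇒< n pp p∣)
... | yes pn with euclidsLemma n (primeProdBelow n) pp p∣
...   | inj₁ p∣n = ℕ.s≤s (ℕ.∣⇒≤ {{prime⇒nonZero pn}} p∣n)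
...   | inj₂ p∣rest = ℕ.m<n⇒m<1+n (prime∣primeProdBelow⇒< n pp p∣rest)

prime<⇒∣primeProdBelow : ∀ {p} n → Prime p → p < n → p ∣ℕ primeProdBelow n
prime<⇒∣primeProdBelow (suc n) pp p<1+n with prime? n | ℕ.m<1+n⇒m<n∨m≡n p<1+n
... | yes _ | inj₁ p<n = ℕ.∣n⇒∣m*n n (prime<⇒∣primeProdBelow n pp p<n)
... | yes _ | inj₂ refl = ℕ.m∣m*n (primeProdBelow n)
... | no _  | inj₁ p<n = prime<⇒∣primeProdBelow n pp p<n
... | no ¬p | inj₂ refl = ⊥-elim (¬p pp)

prime∤4*primeProdBelow : ∀ {n p} → 4 ≤ n → Prime p → n < p → ¬ p ∣ℕ 4 ℕ.* primeProdBelow n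
prime∤4*primeProdBelow {n} 4≤n pp n<p p∣ with euclidsLemma 4 (primeProdBelow n) pp p∣
... | inj₁ p∣4 = ℕ.<⇒≱ (ℕ.≤-<-trans 4≤n n<p) (ℕ.∣⇒≤ p∣4)
... | inj₂ p∣rest = ℕ.<-asym n<p (prime∣primeProdBelow⇒< n pp p∣rest)

-- Residue classes inside a condition

SolvesModulo : ℕ → (ℤ → Set) → ℤ → Set
SolvesModulo M P x = ∀ {y} → y ≡ x mod M → P y

Solvable : (ℤ → Set) → Set
Solvable P = ∃ λ M → NonZero M × ∃ (SolvesModulo M P)

solvesModulo-mono : ∀ {M} {P Q : ℤ → Set} {x} → (∀ {y} → P y → Q y) →
                    SolvesModulo M P x → SolvesModulo M Q x
solvesModulo-mono P⇒Q sol y≡x = P⇒Q (sol y≡x)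

solvable-mono : ∀ {P Q : ℤ → Set} → (∀ {y} → P y → Q y) → Solvable P → Solvable Q
solvable-mono P⇒Q (M , M≢0 , x , sol) = M , M≢0 , x , solvesModulo-mono P⇒Q sol

solvesModulo-∩ : ∀ {M n} {P Q : ℤ → Set} {a b} → Coprime M n →
                 SolvesModulo M P a → SolvesModulo n Q b →
                 ∃ (SolvesModulo (M ℕ.* n) (λ y → P y × Q y))
solvesModulo-∩ {M} {n} c solP solQ with crt c _ _
... | x , x≡a , x≡b = x , λ y≡x →
  solP (≡-mod-trans (≡-mod-∣ (ℕ.m∣m*n n) y≡x) x≡a) ,
  solQ (≡-mod-trans (≡-mod-∣ (ℕ.n∣m*n M) y≡x) x≡b)

solvable-unbounded : ∀ {P : ℤ → Set} → Solvable P → ∀ b → ∃ λ y → b ℤ.< y × P y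
solvable-unbounded (M , M≢0 , x , sol) b = x + + M * t , b<y , sol (≡-mod-intro t (e x (+ M) t))
  where
    t : ℤ
    t = + suc ℤ.∣ b - x ∣
    e : ∀ x m t → x + m * t - x ≡ t * m
    e = solve-∀
    ∣b-x∣<M*t : ℤ.∣ b - x ∣ < M ℕ.* suc ℤ.∣ b - x ∣
    ∣b-x∣<M*t = ℕ.<-≤-trans (ℕ.n<1+n _) (ℕ.m≤n*m _ M {{M≢0}})
    b<y : b ℤ.< x + + M * t
    b<y = begin-strict
      b                                ≡⟨ e′ b x ⟩
      x + (b - x)                      ≤⟨ ℤ.+-monoʳ-≤ x (i≤+∣i∣ (b - x)) ⟩
      x + + ℤ.∣ b - x ∣                <⟨ ℤ.+-monoʳ-< x (ℤ.+<+ ∣b-x∣<M*t) ⟩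
      x + + (M ℕ.* suc ℤ.∣ b - x ∣)    ≡⟨ cong (_+_ x) (ℤ.pos-* M _) ⟩
      x + + M * t                      ∎
      where open ℤ.≤-Reasoning
            e′ : ∀ b x → b ≡ x + (b - x)
            e′ = solve-∀

AtPrimesBelow : ℕ → (ℕ → ℤ → Set) → ℤ → Set
AtPrimesBelow N P x = ∀ {p} → Prime p → p < N → P p x

solvesModulo-primesBelow : (P : ℕ → ℤ → Set) → (∀ {p} → Prime p → ∃ (SolvesModulo p (P p))) →
                           ∀ N → ∃ (SolvesModulo (primeProdBelow N) (AtPrimesBelow N P))
solvesModulo-primesBelow P solP zero = + 0 , λ _ _ ()
solvesModulo-primesBelow P solP (suc N) with prime? N | solvesModulo-primesBelow P solP N
... | no ¬pN | x , sol = x , solvesModulo-mono extend sol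
  where
    extend : ∀ {y} → AtPrimesBelow N P y → AtPrimesBelow (suc N) P y
    extend below pp p<1+N with ℕ.m<1+n⇒m<n∨m≡n p<1+N
    ... | inj₁ p<N = below pp p<N
    ... | inj₂ refl = ⊥-elim (¬pN pp)
... | yes pN | x , sol with solP pN
...   | c , solN = Product.map₂ (solvesModulo-mono combine) (solvesModulo-∩ N⊥ppb solN sol)
  where
    N⊥ppb : Coprime N (primeProdBelow N)
    N⊥ppb = Coprime.sym (prime∤⇒coprime pN λ N∣ → ℕ.<-irrefl refl (prime∣primeProdBelow⇒< N pN N∣))
    combine : ∀ {y} → P N y × AtPrimesBelow N P y → AtPrimesBelow (suc N) P y
    combine (atN , below) pp p<1+N with ℕ.m<1+n⇒m<n∨m≡n p<1+N
    ... | inj₁ p<N = below pp p<N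
    ... | inj₂ refl = atN

SquareShift : ℕ → ℤ → ℤ → Set
SquareShift B a y = ∃ λ r → Prime r × B < r × y ≡ a + + r mod r ℕ.* r

solvable-squareShift : ∀ {P : ℤ → Set} → Solvable P → ∀ B a → Solvable (λ y → P y × SquareShift B a y)
solvable-squareShift (M , M≢0 , x , sol) B a with fresh-prime (M ℕ.+ B)
... | r , pr , M+B<r =
  M ℕ.* (r ℕ.* r) , ℕ.m*n≢0 M (r ℕ.* r) {{M≢0}} {{ℕ.m*n≢0 r r}} ,
  Product.map₂ (solvesModulo-mono (λ (Py , y≡a+r) → Py , r , pr , B<r , y≡a+r))
               (solvesModulo-∩ (coprime-* M⊥r M⊥r) sol (λ y≡a+r → y≡a+r))
  where
    instance
      r≢0 : NonZero r
      r≢0 = prime⇒nonZero pr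
    M⊥r : Coprime M r
    M⊥r = Coprime.sym (prime⇒coprime pr {{M≢0}} (ℕ.m+n≤o⇒m≤o _ M+B<r))
    B<r : B < r
    B<r = ℕ.≤-<-trans (ℕ.m≤n+m B M) M+B<r

-- Admissibility

avoid-residues : ∀ {m p} (f : Fin m → ℤ) → m < p → ∃ λ c → ∀ i → ¬ c ≡ f i mod p
avoid-residues {m} {p} f m<p = decide (Fin.all? hits?)
  where
    Hits : Fin (suc m) → Set
    Hits c = ∃ λ i → + toℕ c ≡ f i mod p
    hits? : ∀ c → Dec (Hits c)
    hits? c = Fin.any? λ i → ≡-mod? (+ toℕ c) (f i) p
    decide : Dec (∀ c → Hits c) → ∃ λ c → ∀ i → ¬ c ≡ f i mod p
    decide (no ¬allHit) = let c , ¬hit = Fin.¬∀⟶∃¬ _ _ hits? ¬allHit in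
      + toℕ c , λ i hit → ¬hit (i , hit)
    decide (yes allHit) with Fin.pigeonhole (ℕ.n<1+n m) (proj₁ ∘ allHit)
    ... | c₁ , c₂ , c₁<c₂ , same =
      ⊥-elim (distinct-residues c₁<c₂ (ℕ.≤-<-trans (Fin.toℕ≤pred[n] c₂) m<p)
                                (≡-mod-trans c₁≡fi (≡-mod-sym c₂≡fi)))
      where
        i : Fin m
        i = proj₁ (allHit c₁)
        c₁≡fi : + toℕ c₁ ≡ f i mod p
        c₁≡fi = proj₂ (allHit c₁)
        c₂≡fi : + toℕ c₂ ≡ f i mod p
        c₂≡fi = subst (λ j → + toℕ c₂ ≡ f j mod p) (sym same) (proj₂ (allHit c₂))

admissible-criterion : ∀ {k} (h : Fin k → ℤ) →
                       (∀ {p} → Prime p → k < p ⊎ (∀ i → h i ≡ + 0 mod p)) → Admissible h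
admissible-criterion h large-or-divides p pp with large-or-divides pp
... | inj₁ k<p = let c , avoids = avoid-residues h k<p in c , λ i c≡hi → avoids i (∣⇒≡-mod c≡hi)
... | inj₂ divides = + 1 , λ i 1≡hi →
  prime∤1 pp (Signed.∣⇒∣ᵤ (_≡_mod_.divides (≡-mod-trans {x = + 1} (∣⇒≡-mod 1≡hi) (divides i))))

admissible-if-multiples : ∀ {k B} (h : Fin k → ℤ) → k < B →
                          (∀ i → h i ≡ + 0 mod primeProdBelow B) → Admissible h
admissible-if-multiples {k} {B} h k<B multiples = admissible-criterion h large-or-divides
  where
    large-or-divides : ∀ {p} → Prime p → k < p ⊎ (∀ i → h i ≡ + 0 mod p)
    large-or-divides {p} pp with k ℕ.<? p
    ... | yes k<p = inj₁ k<p
    ... | no k≮p = inj₂ λ i →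
      ≡-mod-∣ (prime<⇒∣primeProdBelow B pp (ℕ.≤-<-trans (ℕ.≮⇒≥ k≮p) k<B)) (multiples i)

-- Separated sequences

record Separated (B m : ℕ) (u : ℕ → ℤ) : Set where
  field
    starts-at-0 : u 0 ≡ + 0
    increasing : ∀ {i j} → i < j → j < m → u i ℤ.< u j
    exact-prime-divisor : ∀ {i j} → i < j → j < m →
      ∃ λ p → Prime p × B < p × u i ≡ u j mod p × ¬ u i ≡ u j mod p ℕ.* p
    disjoint-prime-divisors : ∀ {i j s t} → i < j → j < m → s < t → t < m → ¬ (i ≡ s × j ≡ t) →
      ∀ {p} → Prime p → B < p → u i ≡ u j mod p → ¬ u s ≡ u t mod p

record NextElement (B m : ℕ) (u : ℕ → ℤ) (x : ℤ) : Set where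
  field
    above : ∀ {i} → i < m → u i ℤ.< x
    new-exact-prime-divisor : ∀ {i} → i < m →
      ∃ λ p → Prime p × B < p × u i ≡ x mod p × ¬ u i ≡ x mod p ℕ.* p
    avoids-old-primes : ∀ {a b i} → a < b → b < m → i < m →
      ∀ {p} → Prime p → B < p → u a ≡ u b mod p → ¬ u i ≡ x mod p

append : ℕ → (ℕ → ℤ) → ℤ → ℕ → ℤ
append m u x n with n ℕ.<? m
... | yes _ = u n
... | no _ = x

append-< : ∀ {m u x n} → n < m → append m u x n ≡ u n
append-< {m} {n = n} n<m with n ℕ.<? m
... | yes _ = refl
... | no n≮m = ⊥-elim (n≮m n<m)

append-≡ : ∀ {m u x} → append m u x m ≡ x
append-≡ {m} with m ℕ.<? m
... | yes m<m = ⊥-elim (ℕ.<-irrefl refl m<m)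
... | no _ = refl

module _ {B m : ℕ} {u : ℕ → ℤ} {x : ℤ} (sep : Separated B m u) (next : NextElement B m u x) where
  open Separated sep
  open NextElement next

  private
    v : ℕ → ℤ
    v = append m u x

    v-old : ∀ {j} → j < m → v j ≡ u j
    v-old = append-<

    v-new : v m ≡ x
    v-new = append-≡ {m} {u}

  avoids-new-primes : ∀ {i s} → i < m → s < m → i ≢ s →
                      ∀ {p} → Prime p → B < p → u i ≡ x mod p → ¬ u s ≡ x mod p
  avoids-new-primes {i} {s} i<m s<m i≢s pp B<p ui≡x us≡x with ℕ.<-cmp i s
  ... | tri< i<s _ _ = avoids-old-primes i<s s<m i<m pp B<p (≡-mod-trans ui≡x (≡-mod-sym us≡x)) ui≡x
  ... | tri≈ _ i≡s _ = i≢s i≡s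
  ... | tri> _ _ s<i = avoids-old-primes s<i i<m i<m pp B<p (≡-mod-trans us≡x (≡-mod-sym ui≡x)) ui≡x

  separated-append : 0 < m → Separated B (suc m) v
  separated-append 0<m = record
    { starts-at-0 = trans (v-old 0<m) starts-at-0
    ; increasing = increasing′
    ; exact-prime-divisor = exact′
    ; disjoint-prime-divisors = disjoint′
    }
    where
      increasing′ : ∀ {i j} → i < j → j < suc m → v i ℤ.< v j
      increasing′ {i} {j} i<j j<1+m with ℕ.m<1+n⇒m<n∨m≡n j<1+m
      ... | inj₁ j<m rewrite v-old j<m | v-old (ℕ.<-trans i<j j<m) = increasing i<j j<m
      ... | inj₂ refl rewrite v-new | v-old i<j = above i<j

      exact′ : ∀ {i j} → i < j → j < suc m →
               ∃ λ p → Prime p × B < p × v i ≡ v j mod p × ¬ v i ≡ v j mod p ℕ.* p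
      exact′ {i} {j} i<j j<1+m with ℕ.m<1+n⇒m<n∨m≡n j<1+m
      ... | inj₁ j<m rewrite v-old j<m | v-old (ℕ.<-trans i<j j<m) = exact-prime-divisor i<j j<m
      ... | inj₂ refl rewrite v-new | v-old i<j = new-exact-prime-divisor i<j

      disjoint′ : ∀ {i j s t} → i < j → j < suc m → s < t → t < suc m → ¬ (i ≡ s × j ≡ t) →
                  ∀ {p} → Prime p → B < p → v i ≡ v j mod p → ¬ v s ≡ v t mod p
      disjoint′ {i} {j} {s} {t} i<j j<1+m s<t t<1+m distinct pp B<p
        with ℕ.m<1+n⇒m<n∨m≡n j<1+m | ℕ.m<1+n⇒m<n∨m≡n t<1+m
      ... | inj₁ j<m | inj₁ t<m
        rewrite v-old j<m | v-old (ℕ.<-trans i<j j<m) | v-old t<m | v-old (ℕ.<-trans s<t t<m)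
        = disjoint-prime-divisors i<j j<m s<t t<m distinct pp B<p
      ... | inj₁ j<m | inj₂ refl
        rewrite v-old j<m | v-old (ℕ.<-trans i<j j<m) | v-new | v-old s<t
        = avoids-old-primes i<j j<m s<t pp B<p
      ... | inj₂ refl | inj₁ t<m
        rewrite v-new | v-old i<j | v-old t<m | v-old (ℕ.<-trans s<t t<m)
        = λ ui≡x us≡ut → avoids-old-primes s<t t<m i<j pp B<p us≡ut ui≡x
      ... | inj₂ refl | inj₂ refl
        rewrite v-new | v-old i<j | v-old s<t
        = avoids-new-primes i<j s<t (λ i≡s → distinct (i≡s , refl)) pp B<p

module _ {B m : ℕ} {u : ℕ → ℤ} (sep : Separated B (suc m) u) (m<B : m < B) where
  open Separated sep

  private
    Avoids : ℕ → ℤ → Set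
    Avoids p x = ∀ {i} → i < suc m → ¬ u i ≡ x mod p

    ≤-last : ∀ {i} → i < suc m → u i ℤ.≤ u m
    ≤-last i<1+m with ℕ.m<1+n⇒m<n∨m≡n i<1+m
    ... | inj₁ i<m = ℤ.<⇒≤ (increasing i<m ℕ.≤-refl)
    ... | inj₂ refl = ℤ.≤-refl

    nonNegative : ∀ {i} → i < suc m → + 0 ℤ.≤ u i
    nonNegative {zero} _ = ℤ.≤-reflexive (sym starts-at-0)
    nonNegative {suc i} i<1+m = subst (ℤ._≤ u (suc i)) starts-at-0 (ℤ.<⇒≤ (increasing ℕ.z<s i<1+m))

    N : ℕ
    N = suc ℤ.∣ u m ∣

    old-prime-bound : ∀ {a b p} → a < b → b < suc m → u a ≡ u b mod p → p < N
    old-prime-bound {a} {b} a<b b<1+m ua≡ub = ℕ.s≤s (ℕ.≤-trans (≡-mod⇒≤∣-∣ (ℤ.<⇒≢ ua<ub) ua≡ub)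
      (∣i-j∣≤∣k∣ (nonNegative (ℕ.<-trans a<b b<1+m)) (ℤ.<⇒≤ ua<ub) (≤-last b<1+m)))
      where ua<ub : u a ℤ.< u b
            ua<ub = increasing a<b b<1+m

    avoidable : ∀ {p} → Prime p → ∃ (SolvesModulo p (λ x → B < p → Avoids p x))
    avoidable {p} pp with B ℕ.<? p
    ... | no B≮p = + 0 , λ _ B<p → ⊥-elim (B≮p B<p)
    ... | yes B<p with avoid-residues (λ (i : Fin (suc m)) → u (toℕ i)) (ℕ.≤-<-trans m<B B<p)
    ...   | c , avoids = c , λ y≡c _ {i} i<1+m ui≡y → avoids (Fin.fromℕ< i<1+m)
              (subst (λ j → c ≡ u j mod p) (sym (Fin.toℕ-fromℕ< i<1+m))
                (≡-mod-sym (≡-mod-trans ui≡y y≡c)))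

    Conditions : ℕ → ℤ → Set
    Conditions n y = AtPrimesBelow N (λ p y → B < p → Avoids p y) y
                   × (∀ {i} → i < n → SquareShift B (u i) y)

    conditions-solvable : ∀ n → Solvable (Conditions n)
    conditions-solvable zero = solvable-mono (λ below → below , λ ())
      (primeProdBelow N , primeProdBelow≢0 N , solvesModulo-primesBelow _ avoidable N)
    conditions-solvable (suc n) = solvable-mono add (solvable-squareShift (conditions-solvable n) B (u n))
      where
        add : ∀ {y} → Conditions n y × SquareShift B (u n) y → Conditions (suc n) y
        add ((below , shifts) , shift) = below , shifts′
          where
            shifts′ : ∀ {i} → i < suc n → SquareShift B (u i) _
            shifts′ i<1+n with ℕ.m<1+n⇒m<n∨m≡n i<1+n
            ... | inj₁ i<n = shifts i<n
            ... | inj₂ refl = shift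

  nextElement-exists : ∃ (NextElement B (suc m) u)
  nextElement-exists = next (solvable-unbounded (conditions-solvable (suc m)) (u m))
    where
      next : (∃ λ x → u m ℤ.< x × Conditions (suc m) x) → ∃ (NextElement B (suc m) u)
      next (x , um<x , below , shifts) = x , record
        { above = λ i<1+m → ℤ.≤-<-trans (≤-last i<1+m) um<x
        ; new-exact-prime-divisor = λ i<1+m → let r , pr , B<r , x≡ui+r = shifts i<1+m in
            r , pr , B<r , ≡-mod-+-exact (prime>1 pr) x≡ui+r
        ; avoids-old-primes = λ a<b b<1+m i<1+m pp B<p ua≡ub →
            below pp (old-prime-bound a<b b<1+m ua≡ub) B<p i<1+m
        }

separated-exists : ∀ B m → 0 < m → m ≤ suc B → ∃ (Separated B m)
separated-exists B (suc zero) _ _ = (λ _ → + 0) , record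
  { starts-at-0 = refl
  ; increasing = λ i<j j<1 → ⊥-elim (no-pair i<j j<1)
  ; exact-prime-divisor = λ i<j j<1 → ⊥-elim (no-pair i<j j<1)
  ; disjoint-prime-divisors = λ i<j j<1 _ _ _ _ _ → ⊥-elim (no-pair i<j j<1)
  }
  where
    no-pair : ∀ {i j} → i < j → j < 1 → ⊥
    no-pair i<j j<1 = ℕ.n≮0 (ℕ.<-≤-trans i<j (ℕ.s≤s⁻¹ j<1))
separated-exists B (suc (suc n)) _ 2+n≤1+B =
  let u , sep = separated-exists B (suc n) ℕ.z<s (ℕ.m≤n⇒m≤1+n (ℕ.s≤s⁻¹ 2+n≤1+B))
      x , next = nextElement-exists sep (ℕ.s≤s⁻¹ 2+n≤1+B)
  in append (suc n) u x , separated-append sep next ℕ.z<s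

module _ {B m : ℕ} {u : ℕ → ℤ} (sep : Separated B m u) (K : ℕ) .{{_ : NonZero K}}
         (large∤K : ∀ {p} → Prime p → B < p → ¬ p ∣ℕ K) where
  open Separated sep

  private
    large⊥K : ∀ {p} → Prime p → B < p → Coprime p K
    large⊥K pp B<p = Coprime.sym (prime∤⇒coprime pp (large∤K pp B<p))

    large²⊥K : ∀ {p} → Prime p → B < p → Coprime (p ℕ.* p) K
    large²⊥K {p} pp B<p = Coprime.sym (coprime-* K⊥p K⊥p)
      where K⊥p : Coprime K p
            K⊥p = Coprime.sym (large⊥K pp B<p)

  separated-* : Separated B m (λ n → + K * u n)
  separated-* = record
    { starts-at-0 = trans (cong (+ K *_) starts-at-0) (ℤ.*-zeroʳ (+ K))
    ; increasing = λ i<j j<m →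
        ℤ.*-monoˡ-<-pos (+ K) {{ℤ.positive (ℤ.+<+ (ℕ.>-nonZero⁻¹ K))}} (increasing i<j j<m)
    ; exact-prime-divisor = λ i<j j<m → let p , pp , B<p , ui≡uj , ui≢uj = exact-prime-divisor i<j j<m in
        p , pp , B<p , ≡-mod-*ˡ (+ K) ui≡uj , ui≢uj ∘ ≡-mod-*ˡ-cancel (large²⊥K pp B<p)
    ; disjoint-prime-divisors = λ i<j j<m s<t t<m distinct pp B<p Kui≡Kuj Kus≡Kut →
        disjoint-prime-divisors i<j j<m s<t t<m distinct pp B<p
          (≡-mod-*ˡ-cancel (large⊥K pp B<p) Kui≡Kuj) (≡-mod-*ˡ-cancel (large⊥K pp B<p) Kus≡Kut)
    }

lemma2p2 : (k : ℕ) → 1 ℕ.< k →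
    ∃ λ (h : Fin k → ℤ) →
      Admissible h
      × (∀ (i : Fin k) → toℕ i ≡ 0 → h i ≡ + 0)
      × (∀ (i j : Fin k) → toℕ i ℕ.< toℕ j → h i ℤ.< h j)
      × (∀ (i : Fin k) → (+ (4 ℕ.* primeProdBelow (2 ℕ.* k))) ∣ h i)
      × (∀ (i j : Fin k) → toℕ i ℕ.< toℕ j →
           ∃ λ (p : ℕ) → Prime p × (2 ℕ.* k) ℕ.< p × (+ p) ∣ (h i - h j)
             × ¬ ((+ (p ℕ.* p)) ∣ (h i - h j)))
      × (∀ (i j s t : Fin k) → toℕ i ℕ.< toℕ j → toℕ s ℕ.< toℕ t →
           ¬ (i ≡ s × j ≡ t) →
           ∀ (p : ℕ) → Prime p → (2 ℕ.* k) ℕ.< p →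
             (+ p) ∣ (h i - h j) → ¬ ((+ p) ∣ (h s - h t)))
lemma2p2 k 1<k =
  h ,
  admissible-if-multiples h k<B (λ i → ≡-mod-∣ (ℕ.n∣m*n 4) (≡-mod-multiple (u (toℕ i)))) ,
  (λ i i≡0 → trans (cong (λ j → + K * u j) i≡0) starts-at-0) ,
  (λ i j i<j → increasing i<j (Fin.toℕ<n j)) ,
  (λ i → Signed.∣⇒∣ᵤ (Signed.∣m⇒∣m*n {+ K} (u (toℕ i)) Signed.∣-refl)) ,
  (λ i j i<j → let p , pp , B<p , hi≡hj , hi≢hj = exact-prime-divisor i<j (Fin.toℕ<n j) in
     p , pp , B<p , ≡-mod⇒∣ hi≡hj , hi≢hj ∘ ∣⇒≡-mod) ,
  (λ i j s t i<j s<t distinct p pp B<p hi≡hj hs≡ht →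
     disjoint-prime-divisors i<j (Fin.toℕ<n j) s<t (Fin.toℕ<n t)
       (λ (i≡s , j≡t) → distinct (Fin.toℕ-injective i≡s , Fin.toℕ-injective j≡t))
       pp B<p (∣⇒≡-mod hi≡hj) (∣⇒≡-mod hs≡ht))
  where
    B K : ℕ
    B = 2 ℕ.* k
    K = 4 ℕ.* primeProdBelow B
    instance
      K≢0 : NonZero K
      K≢0 = ℕ.m*n≢0 4 _ {{_}} {{primeProdBelow≢0 B}}
    k<B : k < B
    k<B = subst (k <_) (ℕ.*-comm k 2) (ℕ.m<m*n k 2 {{ℕ.>-nonZero (ℕ.<-trans ℕ.z<s 1<k)}} ℕ.≤-refl)
    separated : ∃ (Separated B k)
    separated = separated-exists B k (ℕ.<-trans ℕ.z<s 1<k) (ℕ.m≤n⇒m≤1+n (ℕ.<⇒≤ k<B))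
    u : ℕ → ℤ
    u = proj₁ separated
    open Separated (separated-* (proj₂ separated) K (prime∤4*primeProdBelow (ℕ.*-monoʳ-≤ 2 1<k)))
    h : Fin k → ℤ
    h i = + K * u (toℕ i)
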